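{- If $P$ is $\mathbf{CRF}$-healthy then $P\bowtie_F^{\mathbf{1},\emptyset,\mathbf{0}}\Phi(\mathit{true},id,\langle\rangle) = P$. If $P$ is $\mathbf{CRC}$-healthy then $\Phi(\mathit{true},id,\langle\rangle)\,\mathbf{wr}_{\emptyset}\,P = P$.
   Context: UTP setting: relations are predicates over undashed (initial) and dashed (final) variables; $;$ is relational composition; $P\lhd c\rhd Q = (c\wedge P)\vee(\neg c\wedge Q)$. Observational variables: booleans $ok,ok',wait,wait'$; traces $tr,tr'$ (finite event sequences; $\le$ prefix, ${}^\frown$ concatenation, $-$ removal of a prefix); state $st,st'\in\Sigma$; refusal sets $ref,ref'$; $tt$ abbreviates $tr'-tr$. $\mathbf{R1}(P) = P\wedge tr\le tr'$; $\mathbf{R2}(P) = P[\langle\rangle,tr'-tr/tr,tr']\lhd tr\le tr'\rhd P$; $\mathbf{RR}(P)=\exists ok,ok',wait,wait'\bullet\mathbf{R1}(\mathbf{R2}(P))$; $\mathbf{RC}(P) = \mathbf{R1}(\mathbf{RR}(P);(tr'\le tr))$; $\mathbf{CRR}(P)=\exists ref\bullet\mathbf{RR}(P)$; $\mathbf{CRF}(P) = \exists ref,ref'\bullet\mathbf{RR}(P)$; $\mathbf{CRC}(P) = \exists ref\bullet\mathbf{RC}(P)$. $\mathit{true}_r = \mathbf{R1}(\mathit{true})$, $\neg_r P = \mathbf{R1}(\neg P)$. $\Phi(s,\sigma,t) = \mathbf{CRR}(s\wedge st'=\sigma(st)\wedge tt = t)$; $id$ is the identity on $\Sigma$. Lenses: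 a lens $X:V\Rightarrow\Sigma$ is a pair $get_X,put_X$ with $get(put\,s\,v)=v$, $put(put\,s\,v')\,v=put\,s\,v$, $put\,s\,(get\,s)=s$; override $s_1\oplus_X s_2 = put_X\,s_1\,(get_X\,s_2)$; $\mathbf{0}$ is the lens with a singleton view ($put\,s\,v = s$); $\mathbf{1}$ is the identity lens ($get\,s=s$, $put\,s\,v = v$). Parallel-by-merge: $P\parallel_M Q = (P_0\wedge Q_1\wedge v'=v);M$, with $v$ the tuple of all variables, $P_0$ ($Q_1$) obtained by renaming each dashed $x'$ of $P$ ($Q$) to $0.x$ ($1.x$), and $M$ relating $x,0.x,1.x$ to $x'$. Trace merge $\parallel_{cs}$: least function from pairs of event sequences to sets of sequences with $\langle\rangle\parallel_{cs}\langle\rangle = \{\langle\rangle\}$; $(e{:}u)\parallel_{cs}\langle\rangle$ and $\langle\rangle\parallel_{cs}(e{:}u)$ equal $\{\langle\rangle\}$ if $e\in cs$, otherwise $\{\langle e\rangle\}{}^\frown(u\parallel_{cs}\langle\rangle)$, resp. $\{\langle e\rangle\}{}^\frown(\langle\rangle\parallel_{cs}u)$; $(e{:}u_1)\parallel_{cs}(e{:}u_2) = \{\langle e\rangle\}{}^\frown(u_1\parallel_{cs}u_2)$ if $e\in cs$, else $\{\langle e\rangle\}{}^\frown(u_1\parallel_{cs}(e{:}u_2)\cup(e{:}u_1)\parallel_{cs}u_2)$; for $e_1\neq e_2$: $\{\langle\rangle\}$ if both in $cs$, $\{\langle e_2\rangle\}{}^\frown((e_1{:}u_1)\parallel_{cs}u_2)$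 if only $e_1\in cs$, $\{\langle e_1\rangle\}{}^\frown(u_1\parallel_{cs}(e_2{:}u_2))$ if only $e_2\in cs$, the union of these two if neither. $S{}^\frown T = \{a{}^\frown b\mid a\in S,b\in T\}$; $u\restriction cs$ is the subsequence of elements of $u$ in $cs$. Merge: $N(ns_1,cs,ns_2) = (tt\in0.tt\parallel_{cs}1.tt\wedge0.tt\restriction cs = 1.tt\restriction cs\wedge ref'\subseteq((0.ref\cup1.ref)\cap cs)\cup((0.ref\cap1.ref)\setminus cs)\wedge st' = (st\oplus_{ns_1}0.st)\oplus_{ns_2}1.st)$, $0.tt = 0.tr-tr$, $1.tt = 1.tr-tr$. Final merge $P\bowtie_F^{ns_1,cs,ns_2}Q = P\parallel_{\exists ref'\bullet N(ns_1,cs,ns_2)}Q$. Weakest rely $P\,\mathbf{wr}_{cs}\,Q = \neg_r((\neg_r Q)\parallel_{N(\mathbf{0},cs,\mathbf{0});\mathit{true}_r}P)$. -}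

module Defs where

open import Level using (Level; 0ℓ) renaming (suc to lsuc)
open import Data.Bool using (Bool; true; false; T)
open import Data.Unit using (⊤; tt)
open import Data.Empty using (⊥)
open import Data.List using (List; []; _∷_; _++_)
open import Data.Product using (Σ; ∃; _×_; _,_)
open import Data.Sum using (_⊎_)
open import Relation.Nullary using (¬_)
open import Relation.Unary using (Pred)
open import Relation.Binary.PropositionalEquality using (_≡_; _≢_)

record Lens (V : Set) (S : Set) : Set where
  field
    get     : S → V
    put     : S → V → S
    put-get : ∀ s v → get (put s v) ≡ v
    put-put : ∀ s v v' → put (put s v') v ≡ put s v
    get-put : ∀ s → put s (get s) ≡ s
open Lens public

_⊕[_]_ : {V S : Set} → S → Lens V S → S → S
s₁ ⊕[ X ] s₂ = put X s₁ (get X s₂)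

𝟎 : {S : Set} → Lens ⊤ S
𝟎 = record { get = λ _ → tt ; put = λ s _ → s
           ; put-get = λ _ _ → Relation.Binary.PropositionalEquality.refl
           ; put-put = λ _ _ _ → Relation.Binary.PropositionalEquality.refl
           ; get-put = λ _ → Relation.Binary.PropositionalEquality.refl }

𝟏 : {S : Set} → Lens S S
𝟏 = record { get = λ s → s ; put = λ _ v → v
           ; put-get = λ _ _ → Relation.Binary.PropositionalEquality.refl
           ; put-put = λ _ _ _ → Relation.Binary.PropositionalEquality.refl
           ; get-put = λ _ → Relation.Binary.PropositionalEquality.refl }

module UTP (E : Set) (S : Set) where

  _≼_ : List E → List E → Set
  t ≼ t' = ∃ λ u → t' ≡ t ++ u

  -- event sets used as channel sets cs (decidable, given by characteristic fn)
  EvSet : Set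
  EvSet = E → Bool

  ∅ₑ : EvSet
  ∅ₑ _ = false

  _↾_ : List E → EvSet → List E
  [] ↾ cs = []
  (e ∷ u) ↾ cs with cs e
  ... | true  = e ∷ (u ↾ cs)
  ... | false = u ↾ cs

  -- trace merge:  t ∈ u₁ ∥[ cs ] u₂   (the least solution of the defining equations)
  data _∈_∥[_]_ : List E → List E → EvSet → List E → Set where
    m-nil   : ∀ {cs} → [] ∈ [] ∥[ cs ] []
    m-Lcs   : ∀ {cs e u} → T (cs e) → [] ∈ (e ∷ u) ∥[ cs ] []
    m-L     : ∀ {cs e u t} → ¬ T (cs e) → t ∈ u ∥[ cs ] [] → (e ∷ t) ∈ (e ∷ u) ∥[ cs ] []
    m-Rcs   : ∀ {cs e u} → T (cs e) → [] ∈ [] ∥[ cs ] (e ∷ u)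
    m-R     : ∀ {cs e u t} → ¬ T (cs e) → t ∈ [] ∥[ cs ] u → (e ∷ t) ∈ [] ∥[ cs ] (e ∷ u)
    m-sync  : ∀ {cs e u₁ u₂ t} → T (cs e) → t ∈ u₁ ∥[ cs ] u₂ → (e ∷ t) ∈ (e ∷ u₁) ∥[ cs ] (e ∷ u₂)
    m-both  : ∀ {cs e₁ e₂ u₁ u₂} → T (cs e₁) → T (cs e₂) → e₁ ≢ e₂ → [] ∈ (e₁ ∷ u₁) ∥[ cs ] (e₂ ∷ u₂)
    m-left  : ∀ {cs e₁ e₂ u₁ u₂ t} → ¬ T (cs e₁) → t ∈ u₁ ∥[ cs ] (e₂ ∷ u₂)
            → (e₁ ∷ t) ∈ (e₁ ∷ u₁) ∥[ cs ] (e₂ ∷ u₂)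
    m-right : ∀ {cs e₁ e₂ u₁ u₂ t} → ¬ T (cs e₂) → t ∈ (e₁ ∷ u₁) ∥[ cs ] u₂
            → (e₂ ∷ t) ∈ (e₁ ∷ u₁) ∥[ cs ] (e₂ ∷ u₂)

  record Obs : Set₁ where
    constructor obs
    field
      ok   : Bool
      wait : Bool
      tr   : List E
      st   : S
      ref  : Pred E 0ℓ
  open Obs public

  -- relations: predicates over undashed (first) and dashed (second) observations
  Rel : Set₂
  Rel = Obs → Obs → Set₁

  _≐_ : Rel → Rel → Set₁
  P ≐ Q = ∀ v v' → (P v v' → Q v v') × (Q v v' → P v v')

  _[tr≔_] : Obs → List E → Obs
  obs o w _ s r [tr≔ t ] = obs o w t s r
  _[ref≔_] : Obs → Pred E 0ℓ → Obs
  obs o w t s _ [ref≔ r ] = obs o w t s r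
  _[ok,wait≔_,_] : Obs → Bool → Bool → Obs
  obs _ _ t s r [ok,wait≔ o , w ] = obs o w t s r

  -- "tr' - tr = t"  (the difference is defined only when tr ≤ tr')
  TT : Obs → Obs → List E → Set
  TT v v' t = tr v' ≡ tr v ++ t

  _⨟_ : Rel → Rel → Rel
  (P ⨟ Q) v v' = ∃ λ w → P v w × Q w v'

  true' : Rel
  true' _ _ = Level.Lift (lsuc 0ℓ) ⊤

  R1 : Rel → Rel
  R1 P v v' = P v v' × (tr v ≼ tr v')

  -- R2(P) = P[⟨⟩, tr'-tr / tr, tr'] ◁ tr ≤ tr' ▷ P
  R2 : Rel → Rel
  R2 P v v' = (Σ (List E) λ u → TT v v' u × P (v [tr≔ [] ]) (v' [tr≔ u ]))
            ⊎ (¬ (tr v ≼ tr v') × P v v')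

  RR : Rel → Rel
  RR P v v' = ∃ λ o → ∃ λ w → ∃ λ o' → ∃ λ w' →
              R1 (R2 P) (v [ok,wait≔ o , w ]) (v' [ok,wait≔ o' , w' ])

  RC : Rel → Rel
  RC P = R1 (RR P ⨟ (λ w v' → Level.Lift (lsuc 0ℓ) (tr v' ≼ tr w)))

  CRR : Rel → Rel
  CRR P v v' = ∃ λ r → RR P (v [ref≔ r ]) v'

  CRF : Rel → Rel
  CRF P v v' = ∃ λ r → ∃ λ r' → RR P (v [ref≔ r ]) (v' [ref≔ r' ])

  CRC : Rel → Rel
  CRC P v v' = ∃ λ r → RC P (v [ref≔ r ]) v'

  Healthy : (Rel → Rel) → Rel → Set₁
  Healthy H P = H P ≐ P

  true-r : Rel
  true-r = R1 true'

  ¬r_ : Rel → Rel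
  (¬r P) v v' = R1 (λ a b → ¬ P a b) v v'

  Φ : Rel → (S → S) → List E → Rel
  Φ s σ t = CRR (λ v v' → s v v' × Level.Lift (lsuc 0ℓ) (st v' ≡ σ (st v)) × Level.Lift (lsuc 0ℓ) (TT v v' t))

  -- merge predicates relate  v, 0.v, 1.v  to  v'
  Merge : Set₂
  Merge = Obs → Obs → Obs → Obs → Set₁

  -- parallel-by-merge  P ∥_M Q = (P₀ ∧ Q₁ ∧ v' = v) ; M
  _∥[_]_ : Rel → Merge → Rel → Rel
  (P ∥[ M ] Q) v v' = ∃ λ v₀ → ∃ λ v₁ → P v v₀ × Q v v₁ × M v v₀ v₁ v'

  _⨟ₘ_ : Merge → Rel → Merge
  (M ⨟ₘ R) v v₀ v₁ v' = ∃ λ w → M v v₀ v₁ w × R w v'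

  N : {V₁ V₂ : Set} → Lens V₁ S → EvSet → Lens V₂ S → Merge
  N ns₁ cs ns₂ v v₀ v₁ v' =
    Level.Lift (lsuc 0ℓ) (
      Σ (List E) λ t → Σ (List E) λ t₀ → Σ (List E) λ t₁ →
        TT v v' t × TT v v₀ t₀ × TT v v₁ t₁ ×
        t ∈ t₀ ∥[ cs ] t₁ ×
        (t₀ ↾ cs ≡ t₁ ↾ cs) ×
        (∀ e → ref v' e →
             (T (cs e) × (ref v₀ e ⊎ ref v₁ e))
           ⊎ (¬ T (cs e) × ref v₀ e × ref v₁ e)) ×
        (st v' ≡ (st v ⊕[ ns₁ ] st v₀) ⊕[ ns₂ ] st v₁))

  _⋈F[_,_,_]_ : {V₁ V₂ : Set} → Rel → Lens V₁ S → EvSet → Lens V₂ S → Rel → Rel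
  P ⋈F[ ns₁ , cs , ns₂ ] Q = P ∥[ (λ v v₀ v₁ v' → ∃ λ r → N ns₁ cs ns₂ v v₀ v₁ (v' [ref≔ r ])) ] Q

  _wr[_]_ : Rel → EvSet → Rel → Rel
  P wr[ cs ] Q = ¬r ((¬r Q) ∥[ N 𝟎 cs 𝟎 ⨟ₘ true-r ] P)

-- Φ(true, id, ⟨⟩) relates v to v₁ exactly when v₁ keeps the trace and state of v, and merging
-- with an empty right trace over the empty channel set returns the left trace unchanged.  Hence
-- in P ⋈F Φ(true, id, ⟨⟩) the merged observation agrees with P's final observation on tr and st,
-- which is all a CRF-healthy P can see.  In the weakest rely a counterexample is a final
-- observation of ¬r P whose trace is a prefix of tr'; a CRC-healthy P is closed under shortening
-- its final trace, so P itself excludes them, and conversely, classically, P holds whenever no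
-- counterexample exists.
module Submission where

open import Defs
open import Level using (0ℓ; lift) renaming (suc to lsuc)
open import Data.List using ([]; _∷_; _++_)
open import Data.List.Properties using (++-identityʳ; ++-identityʳ-unique; ++-assoc)
open import Data.Product using (_×_; _,_; proj₁; proj₂)
open import Data.Sum using (inj₁; inj₂)
open import Data.Empty using (⊥; ⊥-elim)
open import Data.Unit using (tt)
open import Relation.Nullary using (¬_)
open import Relation.Binary.PropositionalEquality using (_≡_; refl; sym; trans; cong; subst)
open import Axiom.ExcludedMiddle using (ExcludedMiddle)
open import Axiom.DoubleNegationElimination using (em⇒dne)

module SkipLaws (E S : Set) where
  open UTP E S

  ≼-reflexive : ∀ {a b} → a ≡ b → a ≼ b
  ≼-reflexive {a} refl = [] , sym (++-identityʳ a)

  ≼-trans : ∀ {a b c} → a ≼ b → b ≼ c → a ≼ c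
  ≼-trans {a} (u , refl) (w , refl) = u ++ w , ++-assoc a u w

  ↾-∅ : ∀ t → t ↾ ∅ₑ ≡ []
  ↾-∅ []      = refl
  ↾-∅ (e ∷ t) = ↾-∅ t

  ∥∅-identityʳ : ∀ t → t ∈ t ∥[ ∅ₑ ] []
  ∥∅-identityʳ []      = m-nil
  ∥∅-identityʳ (e ∷ t) = m-L (λ ()) (∥∅-identityʳ t)

  ∥∅-[]-inv : ∀ {t t₀} → t ∈ t₀ ∥[ ∅ₑ ] [] → t ≡ t₀
  ∥∅-[]-inv m-nil             = refl
  ∥∅-[]-inv (m-L {e = e} _ m) = cong (e ∷_) (∥∅-[]-inv m)

  module _ {V₁ V₂ : Set} (ns₁ : Lens V₁ S) (ns₂ : Lens V₂ S) (v v₀ v₁ v' : Obs) where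

    N-∅-intro : tr v ≼ tr v₀ → tr v₁ ≡ tr v → tr v' ≡ tr v₀ →
                (∀ e → ¬ ref v' e) → st v' ≡ (st v ⊕[ ns₁ ] st v₀) ⊕[ ns₂ ] st v₁ →
                N ns₁ ∅ₑ ns₂ v v₀ v₁ v'
    N-∅-intro (t , e₀) e₁ e noRef e-st =
      lift ( t , t , [] , trans e e₀ , e₀ , trans e₁ (sym (++-identityʳ (tr v)))
           , ∥∅-identityʳ t , ↾-∅ t , (λ a r → ⊥-elim (noRef a r)) , e-st)

    N-∅-tr : N ns₁ ∅ₑ ns₂ v v₀ v₁ v' → tr v₁ ≡ tr v → tr v' ≡ tr v₀
    N-∅-tr (lift (t , t₀ , t₁ , e , e₀ , e₁ , m , _)) v₁≡v =
      trans e (trans (cong (tr v ++_) t≡t₀) (sym e₀))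
      where
      t₁≡[] : t₁ ≡ []
      t₁≡[] = ++-identityʳ-unique (tr v) (trans (sym v₁≡v) e₁)

      t≡t₀ : t ≡ t₀
      t≡t₀ = ∥∅-[]-inv (subst (t ∈ t₀ ∥[ ∅ₑ ]_) t₁≡[] m)

  Skip : Rel
  Skip = Φ true' (λ s → s) []

  Skip-refl : ∀ v → Skip v v
  Skip-refl v = ref v , ok v , wait v , ok v , wait v
                , inj₁ ([] , sym (++-identityʳ (tr v)) , lift tt , lift refl , lift refl)
                , ≼-reflexive refl

  Skip-tr : ∀ {v v₁} → Skip v v₁ → tr v₁ ≡ tr v
  Skip-tr {v} (_ , _ , _ , _ , _ , inj₁ (u , eq , _ , _ , lift u≡[]) , _) =
    trans eq (trans (cong (tr v ++_) u≡[]) (++-identityʳ (tr v)))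
  Skip-tr (_ , _ , _ , _ , _ , inj₂ (¬prefix , _) , prefix) = ⊥-elim (¬prefix prefix)

  module _ {P : Rel} (healthy : Healthy CRF P) where

    CRF-≼ : ∀ {v v'} → P v v' → tr v ≼ tr v'
    CRF-≼ {v} {v'} p with proj₂ (healthy v v') p
    ... | _ , _ , _ , _ , _ , _ , _ , prefix = prefix

    -- CRF P v a mentions the final observation a only through tr a and st a.
    CRF-respects-tr-st : ∀ {v a b} → P v a → tr a ≡ tr b → st a ≡ st b → P v b
    CRF-respects-tr-st {v} {a} {b} p refl refl =
      proj₁ (healthy v b) (proj₂ (healthy v a) p)

  module _ {P : Rel} (healthy : Healthy CRC P) where

    CRC-≼ : ∀ {v v'} → P v v' → tr v ≼ tr v'
    CRC-≼ {v} {v'} p with proj₂ (healthy v v') p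
    ... | _ , _ , prefix = prefix

    CRC-prefix-closed : ∀ {v a b} → P v a → tr v ≼ tr b → tr b ≼ tr a → P v b
    CRC-prefix-closed {v} {a} {b} p v≼b b≼a with proj₂ (healthy v a) p
    ... | r , (w , rr , lift a≼w) , _ =
      proj₁ (healthy v b) (r , (w , rr , lift (≼-trans b≼a a≼w)) , v≼b)

  ⋈F-Skip-identityʳ : ∀ (P : Rel) → Healthy CRF P → (P ⋈F[ 𝟏 , ∅ₑ , 𝟎 ] Skip) ≐ P
  ⋈F-Skip-identityʳ P healthy v v' = merged⇒P , P⇒merged
    where
    merged⇒P : (P ⋈F[ 𝟏 , ∅ₑ , 𝟎 ] Skip) v v' → P v v'
    merged⇒P (v₀ , v₁ , p , skip , r , n@(lift (_ , _ , _ , _ , _ , _ , _ , _ , _ , e-st))) =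
      CRF-respects-tr-st healthy p
        (sym (N-∅-tr 𝟏 𝟎 v v₀ v₁ (v' [ref≔ r ]) n (Skip-tr {v} {v₁} skip))) (sym e-st)

    P⇒merged : P v v' → (P ⋈F[ 𝟏 , ∅ₑ , 𝟎 ] Skip) v v'
    P⇒merged p = v' , v , p , Skip-refl v , (λ _ → ⊥)
               , N-∅-intro 𝟏 𝟎 v v' v (v' [ref≔ (λ _ → ⊥) ])
                           (CRF-≼ healthy p) refl refl (λ _ ()) refl

  Skip-wr-identity : ExcludedMiddle (lsuc 0ℓ) →
                     ∀ (P : Rel) → Healthy CRC P → (Skip wr[ ∅ₑ ] P) ≐ P
  Skip-wr-identity em P healthy v v' = wr⇒P , P⇒wr
    where
    wr⇒P : (Skip wr[ ∅ₑ ] P) v v' → P v v'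
    wr⇒P (noCounterexample , v≼v') = em⇒dne em λ ¬p →
      noCounterexample
        ( v' , v , (¬p , v≼v') , Skip-refl v
        , w , N-∅-intro 𝟎 𝟎 v v' v w v≼v' refl refl (λ _ ()) refl
        , lift tt , ≼-reflexive refl)
      where
      w : Obs
      w = obs (ok v) (wait v) (tr v') (st v) (λ _ → ⊥)

    P⇒wr : P v v' → (Skip wr[ ∅ₑ ] P) v v'
    P⇒wr p = noCounterexample , CRC-≼ healthy p
      where
      noCounterexample : ¬ ((¬r P) ∥[ N 𝟎 ∅ₑ 𝟎 ⨟ₘ true-r ] Skip) v v'
      noCounterexample (v₀ , v₁ , (¬p₀ , v≼v₀) , skip , w , n , _ , w≼v') =
        ¬p₀ (CRC-prefix-closed healthy p v≼v₀ (≼-trans (≼-reflexive v₀≡w) w≼v'))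
        where
        v₀≡w : tr v₀ ≡ tr w
        v₀≡w = sym (N-∅-tr 𝟎 𝟎 v v₀ v₁ w n (Skip-tr {v} {v₁} skip))

theorem45 : ExcludedMiddle (lsuc 0ℓ) → (E S : Set) →
    let open UTP E S in
      (∀ (P : Rel) → Healthy CRF P → (P ⋈F[ 𝟏 , ∅ₑ , 𝟎 ] Φ true' (λ s → s) []) ≐ P)
    × (∀ (P : Rel) → Healthy CRC P → (Φ true' (λ s → s) [] wr[ ∅ₑ ] P) ≐ P)
theorem45 em E S = ⋈F-Skip-identityʳ , Skip-wr-identity em
  where open SkipLaws E S
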